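{- For any positive integers $r,n$ with $r\le n$, there exists an induced subgraph $G_r$ of $L_r(n)$ that contains no cycle of length $6$ and satisfies \[ e(G_r) > \frac{c}{2}\cdot e(L_r(n)), \qquad \text{where } c=\prod_{k=1}^\infty\left(1-\frac{1}{2^k}\right). \]
   Context: Identify the vertices of the hypercube $Q_n$ (vertex set $\{0,1\}^n$, edges between vertices differing in exactly one coordinate) with subsets of $[n]=\{1,\dots,n\}$. For $r\le n$, the $r$-th layer $L_r(n)$ is the subgraph of $Q_n$ consisting of the edges between $\binom{[n]}{r-1}$ and $\binom{[n]}{r}$ (together with these vertices), where $\binom{[n]}{r}$ is the family of $r$-element subsets of $[n]$. $e(\cdot)$ denotes the number of edges. -}

module Defs where

open import Data.Nat using (ℕ; zero; suc; _+_; _*_; _∸_; _^_; _<_)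
open import Data.Nat.Properties using (_≟_)
open import Data.Bool using (Bool; true; false; T; _∧_)
open import Data.Bool.Properties using (T?)
open import Data.Vec using (Vec; []; _∷_)
open import Data.List using (List; []; _∷_; _++_; map; length; filter; cartesianProduct)
open import Data.Fin using (Fin; zero; suc)
open import Data.Fin.Subset using (Subset; inside; outside; ∣_∣; _⊆_)
open import Data.Fin.Subset.Properties using (_⊆?_)
open import Data.Product using (_×_; _,_; proj₁; proj₂; ∃)
open import Data.Sum using (_⊎_)
open import Relation.Binary.PropositionalEquality using (_≡_)
open import Relation.Nullary using (¬_; Dec)
open import Relation.Nullary.Decidable using (_×-dec_)

subsets : (n : ℕ) → List (Subset n)
subsets zero = [] ∷ []
subsets (suc n) = map (inside ∷_) (subsets n) ++ map (outside ∷_) (subsets n)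

-- Directed description of an edge of the r-th layer L_r(n):
-- A ∈ ([n] choose r-1), B ∈ ([n] choose r), A ⊆ B.  (r ≥ 1 is assumed where used.)
LEdge : {n : ℕ} → ℕ → Subset n → Subset n → Set
LEdge r A B = (∣ A ∣ ≡ r ∸ 1) × (∣ B ∣ ≡ r) × (A ⊆ B)

LEdge? : {n : ℕ} (r : ℕ) (A B : Subset n) → Dec (LEdge r A B)
LEdge? r A B = (∣ A ∣ ≟ r ∸ 1) ×-dec ((∣ B ∣ ≟ r) ×-dec (A ⊆? B))

layerEdges : (n r : ℕ) → List (Subset n × Subset n)
layerEdges n r = filter (λ p → LEdge? r (proj₁ p) (proj₂ p)) (cartesianProduct (subsets n) (subsets n))

eLayer : ℕ → ℕ → ℕ
eLayer n r = length (layerEdges n r)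

-- An induced subgraph of L_r(n) is given by its vertex set S (a Boolean predicate).
-- S is a vertex set of L_r(n): every chosen vertex has size r-1 or r.
IsLayerVertexSet : {n : ℕ} → ℕ → (Subset n → Bool) → Set
IsLayerVertexSet r S = ∀ A → T (S A) → (∣ A ∣ ≡ r ∸ 1) ⊎ (∣ A ∣ ≡ r)

eInduced : (n r : ℕ) → (Subset n → Bool) → ℕ
eInduced n r S = length (filter (λ p → T? (S (proj₁ p) ∧ S (proj₂ p))) (layerEdges n r))

Adj : {n : ℕ} → ℕ → (Subset n → Bool) → Subset n → Subset n → Set
Adj r S x y = T (S x) × T (S y) × (LEdge r x y ⊎ LEdge r y x)

next6 : Fin 6 → Fin 6
next6 zero = suc zero
next6 (suc zero) = suc (suc zero)
next6 (suc (suc zero)) = suc (suc (suc zero))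
next6 (suc (suc (suc zero))) = suc (suc (suc (suc zero)))
next6 (suc (suc (suc (suc zero)))) = suc (suc (suc (suc (suc zero))))
next6 (suc (suc (suc (suc (suc zero))))) = zero

HasC6 : {n : ℕ} → ℕ → (Subset n → Bool) → Set
HasC6 {n} r S = ∃ λ (v : Fin 6 → Subset n) →
  (∀ i j → v i ≡ v j → i ≡ j) × (∀ i → Adj r S (v i) (v (next6 i)))

C6Free : {n : ℕ} → ℕ → (Subset n → Bool) → Set
C6Free r S = ¬ HasC6 r S

-- Product ∏_{k=1}^{K} (2^k - 1) and exponent ∑_{k=1}^{K} k = K(K+1)/2, so that
-- the partial product P_K = ∏_{k=1}^{K} (1 - 2^{-k}) = prodNum K / 2 ^ tri K.
prodNum : ℕ → ℕ
prodNum zero = 1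
prodNum (suc K) = prodNum K * (2 ^ suc K ∸ 1)

tri : ℕ → ℕ
tri zero = 0
tri (suc K) = tri K + suc K

-- x > (c/2)·y  where c = ∏_{k≥1}(1 - 2^{-k}) = inf_K P_K (strictly decreasing, not attained):
-- equivalently ∃ K, x > (P_K/2)·y, i.e. 2·2^{tri K}·x > prodNum K · y.
GtHalfC : ℕ → ℕ → Set
GtHalfC x y = ∃ λ (K : ℕ) → prodNum K * y < 2 * 2 ^ tri K * x

{-# OPTIONS --safe #-}
-- Write r = k + 1 and fix vectors u, v₁, …, vₙ ∈ F₂ʳ. Keep an r-set B when (vᵢ)_{i∈B} is a
-- basis of F₂ʳ, and a k-set A when u together with (vᵢ)_{i∈A} is one. For a uniformly random
-- choice of the vectors an edge A ⊂ B of L_r(n) survives with probability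
-- ½ ∏_{i=1}^{r} (1 − 2⁻ⁱ) > c/2, so some choice keeps more than (c/2)·e(L_r(n)) edges.
-- A surviving 6-cycle B₁A₁B₂A₂B₃A₃ has B₂, B₃ ⊆ B₁ ∪ {y} for a single index y. Writing u in
-- each basis Bⱼ, two of the three representations never agree at y (they would then coincide,
-- putting u in the span of the shared A), which three elements of F₂ cannot achieve.
module Submission where

open import Defs
open import Algebra.Bundles using (AbelianGroup)
import Algebra.Properties.AbelianGroup as AbelianGroupProperties
import Algebra.Properties.CommutativeSemigroup as CommutativeSemigroupProperties
open import Data.Bool using (Bool; true; false; T; not; _∧_; _∨_; _xor_)
open import Data.Bool.Properties
  using (T?; ∧-zeroʳ; ∧-identityʳ; xor-assoc; xor-comm; xor-identityˡ; xor-identityʳ; xor-same)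
  renaming (_≟_ to _≟ᵇ_)
open import Data.Empty using (⊥; ⊥-elim)
open import Data.Unit using (⊤; tt)
open import Data.Fin using (Fin; zero; suc; #_)
open import Data.Fin.Subset using (Subset; inside; outside; ∣_∣; _⊆_; _∈_; _∉_; _∪_; ⁅_⁆) renaming (⊥ to ∅)
open import Data.Fin.Subset.Properties
  using (_∈?_; drop-∷-⊆; out⊆; in⊆in; ⊥⊆; ⊆-refl; ⊆-trans; ⊆-antisym; p⊆p∪q; p⊂q⇒∣p∣<∣q∣; x∈p∪q⁻; x∈p∪q⁺; x∈⁅x⁆; x∈⁅y⁆⇒x≡y; ∣⊥∣≡0)
open import Data.List using (List; []; _∷_; [_]; _++_; map; concatMap; length; filter; cartesianProduct)
open import Data.List.Membership.Propositional using () renaming (_∈_ to _∈ₗ_; _∉_ to _∉ₗ_)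
open import Data.List.Properties using (length-++; length-map)
import Data.List.Membership.DecPropositional as DecMembership
open import Data.List.Relation.Binary.Disjoint.Propositional using (Disjoint)
open import Data.List.Relation.Unary.AllPairs using ([]; _∷_)
open import Data.List.Relation.Unary.All using ([])
open import Data.List.Relation.Unary.All.Properties using (All¬⇒¬Any)
open import Data.List.Relation.Unary.Unique.Propositional using (Unique)
import Data.List.Relation.Unary.Unique.Propositional.Properties as Unique
open import Data.List.Membership.Propositional.Properties
  using (∈-++⁺ˡ; ∈-++⁺ʳ; ∈-++⁻; ∈-map⁺; ∈-map⁻; ∈-filter⁺; ∈-filter⁻; ∈-cartesianProduct⁺)
open import Data.List.Relation.Unary.Any using () renaming (here to hereₗ; there to thereₗ)
open import Data.Nat using (ℕ; zero; suc; _+_; _*_; _∸_; _^_; _≤_; _<_; z≤n; s≤s; >-nonZero)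
open import Data.Nat.Properties
open import Data.Nat.Tactic.RingSolver using (solve-∀)
open CommutativeSemigroupProperties +-commutativeSemigroup using () renaming (interchange to +-interchange)
open import Data.Product using (∃; _×_; _,_; proj₁; proj₂)
open import Data.Sum as Sum using (_⊎_; inj₁; inj₂)
open import Data.Vec using (Vec; []; _∷_; replicate; zipWith; here; there)
open import Data.Vec.Properties using (≡-dec; zipWith-assoc; zipWith-comm; zipWith-identityˡ; zipWith-identityʳ)
open import Function using (id; _∘_; _⇔_; mk⇔; Equivalence)
open import Level using (0ℓ)
open import Relation.Binary.PropositionalEquality
  using (_≡_; _≢_; refl; sym; trans; cong; cong₂; subst; isEquivalence; module ≡-Reasoning)
open import Relation.Binary.Definitions using (DecidableEquality)
open import Relation.Nullary.Decidable using (dec-false; dec-true; does-⇔)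
open import Relation.Nullary using (Dec; yes; no; does; ¬?; _×-dec_; _⊎-dec_)

⟦_⟧ : Bool → ℕ
⟦ true ⟧ = 1
⟦ false ⟧ = 0

⟦⟧≤1 : ∀ b → ⟦ b ⟧ ≤ 1
⟦⟧≤1 true = ≤-refl
⟦⟧≤1 false = z≤n

⟦not⟧+⟦⟧ : ∀ b → ⟦ not b ⟧ + ⟦ b ⟧ ≡ 1
⟦not⟧+⟦⟧ true = refl
⟦not⟧+⟦⟧ false = refl

module _ {A : Set} where

  ∑ : List A → (A → ℕ) → ℕ
  ∑ [] f = 0
  ∑ (x ∷ xs) f = f x + ∑ xs f

  syntax ∑ xs (λ x → e) = ∑[ x ← xs ] e

  ∑-++ : ∀ xs ys (f : A → ℕ) → ∑ (xs ++ ys) f ≡ ∑ xs f + ∑ ys f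
  ∑-++ [] ys f = refl
  ∑-++ (x ∷ xs) ys f = trans (cong (f x +_) (∑-++ xs ys f)) (sym (+-assoc (f x) _ _))

  ∑-cong : ∀ xs {f g : A → ℕ} → (∀ x → f x ≡ g x) → ∑ xs f ≡ ∑ xs g
  ∑-cong [] f≗g = refl
  ∑-cong (x ∷ xs) f≗g = cong₂ _+_ (f≗g x) (∑-cong xs f≗g)

  ∑-mono-≤ : ∀ xs {f g : A → ℕ} → (∀ x → f x ≤ g x) → ∑ xs f ≤ ∑ xs g
  ∑-mono-≤ [] f≤g = z≤n
  ∑-mono-≤ (x ∷ xs) f≤g = +-mono-≤ (f≤g x) (∑-mono-≤ xs f≤g)

  ∑-+ : ∀ xs (f g : A → ℕ) → ∑[ x ← xs ] (f x + g x) ≡ ∑ xs f + ∑ xs g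
  ∑-+ [] f g = refl
  ∑-+ (x ∷ xs) f g = trans (cong (f x + g x +_) (∑-+ xs f g)) (+-interchange (f x) (g x) _ _)

  ∑-*ˡ : ∀ xs c (f : A → ℕ) → ∑[ x ← xs ] (c * f x) ≡ c * ∑ xs f
  ∑-*ˡ [] c f = sym (*-zeroʳ c)
  ∑-*ˡ (x ∷ xs) c f = trans (cong (c * f x +_) (∑-*ˡ xs c f)) (sym (*-distribˡ-+ c (f x) _))

  ∑-constant-on : ∀ xs {f : A → ℕ} c → (∀ x → x ∈ₗ xs → f x ≡ c) → ∑ xs f ≡ length xs * c
  ∑-constant-on [] c f≡c = refl
  ∑-constant-on (x ∷ xs) c f≡c = cong₂ _+_ (f≡c x (hereₗ refl)) (∑-constant-on xs c (λ y → f≡c y ∘ thereₗ))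

  length≡∑1 : ∀ xs → length xs ≡ ∑[ x ← xs ] 1
  length≡∑1 xs = sym (trans (∑-constant-on xs 1 (λ _ _ → refl)) (*-identityʳ (length xs)))

  length-filter-T? : ∀ xs (p : A → Bool) → length (filter (λ x → T? (p x)) xs) ≡ ∑[ x ← xs ] ⟦ p x ⟧
  length-filter-T? [] p = refl
  length-filter-T? (x ∷ xs) p with p x
  ... | true = cong suc (length-filter-T? xs p)
  ... | false = length-filter-T? xs p

  ∃-≥-average : A → ∀ xs (f : A → ℕ) → ∃ λ x → ∑ xs f ≤ length xs * f x
  ∃-≥-average d [] f = d , z≤n
  ∃-≥-average d (x ∷ xs) f with ∃-≥-average d xs f
  ... | y , ∑≤ with f x ≤? f y
  ...   | yes fx≤fy = y , +-mono-≤ fx≤fy ∑≤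
  ...   | no fx≰fy = x , +-monoʳ-≤ (f x) (≤-trans ∑≤ (*-monoʳ-≤ (length xs) (<⇒≤ (≰⇒> fx≰fy))))

∑-zero : ∀ {A : Set} (xs : List A) → ∑[ x ← xs ] 0 ≡ 0
∑-zero xs = trans (∑-constant-on xs 0 (λ _ _ → refl)) (*-zeroʳ (length xs))

∑-map : ∀ {A B : Set} (g : A → B) xs (f : B → ℕ) → ∑ (map g xs) f ≡ ∑ xs (f ∘ g)
∑-map g [] f = refl
∑-map g (x ∷ xs) f = cong (f (g x) +_) (∑-map g xs f)

∑-swap : ∀ {A B : Set} xs ys (f : A → B → ℕ) → ∑[ x ← xs ] ∑[ y ← ys ] f x y ≡ ∑[ y ← ys ] ∑[ x ← xs ] f x y
∑-swap [] ys f = sym (∑-zero ys)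
∑-swap (x ∷ xs) ys f = trans (cong (∑ ys (f x) +_) (∑-swap xs ys f)) (sym (∑-+ ys (f x) _))

allVecs : {A : Set} → List A → (m : ℕ) → List (Vec A m)
allVecs xs zero = [ [] ]
allVecs xs (suc m) = concatMap (λ x → map (x ∷_) (allVecs xs m)) xs

∑-concatMap : ∀ {A B : Set} (g : A → List B) xs (f : B → ℕ) → ∑ (concatMap g xs) f ≡ ∑[ x ← xs ] ∑ (g x) f
∑-concatMap g [] f = refl
∑-concatMap g (x ∷ xs) f = trans (∑-++ (g x) _ f) (cong (∑ (g x) f +_) (∑-concatMap g xs f))

∑-allVecs-suc : ∀ {A : Set} (xs : List A) m (f : Vec A (suc m) → ℕ) →
                ∑ (allVecs xs (suc m)) f ≡ ∑[ x ← xs ] ∑[ v ← allVecs xs m ] f (x ∷ v)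
∑-allVecs-suc xs m f =
  trans (∑-concatMap (λ x → map (x ∷_) (allVecs xs m)) xs f) (∑-cong xs (λ x → ∑-map (x ∷_) (allVecs xs m) f))

length-allVecs : ∀ {A : Set} (xs : List A) m → length (allVecs xs m) ≡ length xs ^ m
length-allVecs xs zero = refl
length-allVecs xs (suc m) = begin
  length (allVecs xs (suc m))                 ≡⟨ length≡∑1 (allVecs xs (suc m)) ⟩
  ∑ (allVecs xs (suc m)) (λ _ → 1)            ≡⟨ ∑-allVecs-suc xs m (λ _ → 1) ⟩
  ∑[ x ← xs ] ∑[ v ← allVecs xs m ] 1         ≡⟨ ∑-constant-on xs _ (λ _ _ → trans (sym (length≡∑1 (allVecs xs m))) (length-allVecs xs m)) ⟩
  length xs * length xs ^ m                   ∎
  where open ≡-Reasoning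

∑-subsets-suc : ∀ n (f : Subset (suc n) → ℕ) →
                ∑ (subsets (suc n)) f ≡ ∑[ X ← subsets n ] f (inside ∷ X) + ∑[ X ← subsets n ] f (outside ∷ X)
∑-subsets-suc n f =
  trans (∑-++ (map (inside ∷_) (subsets n)) _ f) (cong₂ _+_ (∑-map (inside ∷_) (subsets n) f) (∑-map (outside ∷_) (subsets n) f))

length-subsets : ∀ n → length (subsets n) ≡ 2 ^ n
length-subsets zero = refl
length-subsets (suc n) = begin
  length (subsets (suc n))                                           ≡⟨ length≡∑1 (subsets (suc n)) ⟩
  ∑ (subsets (suc n)) (λ _ → 1)                                      ≡⟨ ∑-subsets-suc n (λ _ → 1) ⟩
  ∑[ X ← subsets n ] 1 + ∑[ X ← subsets n ] 1                        ≡⟨ cong (λ k → k + k) (sym (length≡∑1 (subsets n))) ⟩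
  length (subsets n) + length (subsets n)                            ≡⟨ cong (λ k → k + k) (length-subsets n) ⟩
  2 ^ n + 2 ^ n                                                      ≡⟨ cong (2 ^ n +_) (sym (+-identityʳ (2 ^ n))) ⟩
  2 ^ suc n                                                          ∎
  where open ≡-Reasoning

∈-subsets : ∀ {n} (X : Subset n) → X ∈ₗ subsets n
∈-subsets [] = hereₗ refl
∈-subsets {suc n} (inside ∷ X) = ∈-++⁺ˡ (∈-map⁺ (inside ∷_) (∈-subsets X))
∈-subsets {suc n} (outside ∷ X) = ∈-++⁺ʳ (map (inside ∷_) (subsets n)) (∈-map⁺ (outside ∷_) (∈-subsets X))

-- Vectors of F₂ʳ and subsets of [m] are both Vec Bool (so `subsets r` enumerates F₂ʳ);
-- on subsets ⊕ is symmetric difference.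
infixl 6 _⊕_

_⊕_ : ∀ {k} → Vec Bool k → Vec Bool k → Vec Bool k
_⊕_ = zipWith _xor_

𝟎 : ∀ {k} → Vec Bool k
𝟎 = replicate _ false

⊕-self : ∀ {k} (x : Vec Bool k) → x ⊕ x ≡ 𝟎
⊕-self [] = refl
⊕-self (b ∷ x) = cong₂ _∷_ (xor-same b) (⊕-self x)

⊕-abelianGroup : ℕ → AbelianGroup 0ℓ 0ℓ
⊕-abelianGroup k = record
  { Carrier = Vec Bool k
  ; _≈_ = _≡_
  ; _∙_ = _⊕_
  ; ε = 𝟎
  ; _⁻¹ = id
  ; isAbelianGroup = record
    { isGroup = record
      { isMonoid = record
        { isSemigroup = record
          { isMagma = record { isEquivalence = isEquivalence ; ∙-cong = cong₂ _⊕_ }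
          ; assoc = zipWith-assoc xor-assoc
          }
        ; identity = zipWith-identityˡ xor-identityˡ , zipWith-identityʳ xor-identityʳ
        }
      ; inverse = ⊕-self , ⊕-self
      ; ⁻¹-cong = id
      }
    ; comm = zipWith-comm xor-comm
    }
  }

module F₂ {k : ℕ} where
  open AbelianGroup (⊕-abelianGroup k) public using (assoc; identityˡ)
  open AbelianGroupProperties (⊕-abelianGroup k) public using (∙-cancelˡ; inverseˡ-unique; //-rightDividesʳ)
  open CommutativeSemigroupProperties (AbelianGroup.commutativeSemigroup (⊕-abelianGroup k)) public
    using (interchange; x∙yz≈y∙xz)

⊕-cancel-middle : ∀ {k} (x y z : Vec Bool k) → (x ⊕ y) ⊕ (y ⊕ z) ≡ x ⊕ z
⊕-cancel-middle x y z = begin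
  (x ⊕ y) ⊕ (y ⊕ z)  ≡⟨ F₂.assoc x y (y ⊕ z) ⟩
  x ⊕ (y ⊕ (y ⊕ z))  ≡⟨ cong (x ⊕_) (F₂.assoc y y z) ⟨
  x ⊕ ((y ⊕ y) ⊕ z)  ≡⟨ cong (λ v → x ⊕ (v ⊕ z)) (⊕-self y) ⟩
  x ⊕ (𝟎 ⊕ z)        ≡⟨ cong (x ⊕_) (F₂.identityˡ z) ⟩
  x ⊕ z              ∎
  where open ≡-Reasoning

∈-⊕⁻ : ∀ {m} (Y Z : Subset m) {i} → i ∈ Y ⊕ Z → i ∈ Y ⊎ i ∈ Z
∈-⊕⁻ (inside ∷ Y) (outside ∷ Z) here = inj₁ here
∈-⊕⁻ (outside ∷ Y) (inside ∷ Z) here = inj₂ here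
∈-⊕⁻ (_ ∷ Y) (_ ∷ Z) (there i∈Y⊕Z) = Sum.map there there (∈-⊕⁻ Y Z i∈Y⊕Z)

∈∧∈⇒∉⊕ : ∀ {m} {Y Z : Subset m} {i} → i ∈ Y → i ∈ Z → i ∉ Y ⊕ Z
∈∧∈⇒∉⊕ here here ()
∈∧∈⇒∉⊕ (there i∈Y) (there i∈Z) (there i∈Y⊕Z) = ∈∧∈⇒∉⊕ i∈Y i∈Z i∈Y⊕Z

⊕-⊆ : ∀ {m} {X Y Z : Subset m} → Y ⊆ X → Z ⊆ X → Y ⊕ Z ⊆ X
⊕-⊆ {Y = Y} {Z} Y⊆X Z⊆X i∈Y⊕Z = Sum.[ Y⊆X , Z⊆X ] (∈-⊕⁻ Y Z i∈Y⊕Z)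

lincomb : ∀ {r m} → Vec (Vec Bool r) m → Subset m → Vec Bool r
lincomb [] [] = 𝟎
lincomb (w ∷ V) (inside ∷ Y) = w ⊕ lincomb V Y
lincomb (w ∷ V) (outside ∷ Y) = lincomb V Y

lincomb-⊕ : ∀ {r m} (V : Vec (Vec Bool r) m) Y Z → lincomb V (Y ⊕ Z) ≡ lincomb V Y ⊕ lincomb V Z
lincomb-⊕ [] [] [] = sym (F₂.identityˡ 𝟎)
lincomb-⊕ (w ∷ V) (inside ∷ Y) (inside ∷ Z) = begin
  lincomb V (Y ⊕ Z)                          ≡⟨ lincomb-⊕ V Y Z ⟩
  lincomb V Y ⊕ lincomb V Z                  ≡⟨ F₂.identityˡ _ ⟨
  𝟎 ⊕ (lincomb V Y ⊕ lincomb V Z)            ≡⟨ cong (_⊕ (lincomb V Y ⊕ lincomb V Z)) (⊕-self w) ⟨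
  (w ⊕ w) ⊕ (lincomb V Y ⊕ lincomb V Z)      ≡⟨ F₂.interchange w w _ _ ⟩
  (w ⊕ lincomb V Y) ⊕ (w ⊕ lincomb V Z)      ∎
  where open ≡-Reasoning
lincomb-⊕ (w ∷ V) (inside ∷ Y) (outside ∷ Z) = trans (cong (w ⊕_) (lincomb-⊕ V Y Z)) (sym (F₂.assoc w _ _))
lincomb-⊕ (w ∷ V) (outside ∷ Y) (inside ∷ Z) = trans (cong (w ⊕_) (lincomb-⊕ V Y Z)) (F₂.x∙yz≈y∙xz w _ _)
lincomb-⊕ (w ∷ V) (outside ∷ Y) (outside ∷ Z) = lincomb-⊕ V Y Z

span : ∀ {r m} → Vec (Vec Bool r) m → Subset m → List (Vec Bool r)
span [] [] = [ 𝟎 ]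
span (w ∷ V) (inside ∷ X) = span V X ++ map (w ⊕_) (span V X)
span (w ∷ V) (outside ∷ X) = span V X

∈-span⁺ : ∀ {r m} (V : Vec (Vec Bool r) m) {X Y} → Y ⊆ X → lincomb V Y ∈ₗ span V X
∈-span⁺ [] {[]} {[]} _ = hereₗ refl
∈-span⁺ (w ∷ V) {inside ∷ X} {inside ∷ Y} Y⊆X = ∈-++⁺ʳ (span V X) (∈-map⁺ (w ⊕_) (∈-span⁺ V (drop-∷-⊆ Y⊆X)))
∈-span⁺ (w ∷ V) {inside ∷ X} {outside ∷ Y} Y⊆X = ∈-++⁺ˡ (∈-span⁺ V (drop-∷-⊆ Y⊆X))
∈-span⁺ (w ∷ V) {outside ∷ X} {inside ∷ Y} Y⊆X with () ← Y⊆X here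
∈-span⁺ (w ∷ V) {outside ∷ X} {outside ∷ Y} Y⊆X = ∈-span⁺ V (drop-∷-⊆ Y⊆X)

∈-span⁻ : ∀ {r m} (V : Vec (Vec Bool r) m) X {u} → u ∈ₗ span V X → ∃ λ Y → Y ⊆ X × lincomb V Y ≡ u
∈-span⁻ [] [] (hereₗ refl) = [] , (λ ()) , refl
∈-span⁻ (w ∷ V) (inside ∷ X) u∈ with ∈-++⁻ (span V X) u∈
... | inj₁ u∈span with Y , Y⊆X , refl ← ∈-span⁻ V X u∈span = outside ∷ Y , out⊆ Y⊆X , refl
... | inj₂ u∈w⊕span with v , v∈span , refl ← ∈-map⁻ (w ⊕_) u∈w⊕span
                     with Y , Y⊆X , refl ← ∈-span⁻ V X v∈span = inside ∷ Y , in⊆in Y⊆X , refl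
∈-span⁻ (w ∷ V) (outside ∷ X) u∈ with Y , Y⊆X , refl ← ∈-span⁻ V X u∈ = outside ∷ Y , out⊆ Y⊆X , refl

span-⊕ : ∀ {r m} (V : Vec (Vec Bool r) m) X {a b} → a ∈ₗ span V X → b ∈ₗ span V X → a ⊕ b ∈ₗ span V X
span-⊕ V X a∈ b∈ with Y , Y⊆X , refl ← ∈-span⁻ V X a∈ | Z , Z⊆X , refl ← ∈-span⁻ V X b∈ =
  subst (_∈ₗ span V X) (lincomb-⊕ V Y Z) (∈-span⁺ V (⊕-⊆ Y⊆X Z⊆X))

span-mono : ∀ {r m} (V : Vec (Vec Bool r) m) {A B} → A ⊆ B → ∀ {u} → u ∈ₗ span V A → u ∈ₗ span V B
span-mono V {A} A⊆B u∈ with Y , Y⊆A , refl ← ∈-span⁻ V A u∈ = ∈-span⁺ V (⊆-trans Y⊆A A⊆B)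

length-span : ∀ {r m} (V : Vec (Vec Bool r) m) X → length (span V X) ≡ 2 ^ ∣ X ∣
length-span [] [] = refl
length-span (w ∷ V) (inside ∷ X) = begin
  length (span V X ++ map (w ⊕_) (span V X))       ≡⟨ length-++ (span V X) ⟩
  length (span V X) + length (map (w ⊕_) (span V X)) ≡⟨ cong (length (span V X) +_) (length-map (w ⊕_) (span V X)) ⟩
  length (span V X) + length (span V X)            ≡⟨ cong (λ k → k + k) (length-span V X) ⟩
  2 ^ ∣ X ∣ + 2 ^ ∣ X ∣                             ≡⟨ cong (2 ^ ∣ X ∣ +_) (+-identityʳ (2 ^ ∣ X ∣)) ⟨
  2 ^ suc ∣ X ∣                                     ∎
  where open ≡-Reasoning
length-span (w ∷ V) (outside ∷ X) = length-span V X

_≟ᵥ_ : ∀ {r} → DecidableEquality (Vec Bool r)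
_≟ᵥ_ = ≡-dec _≟ᵇ_

_∈ₗ?_ : ∀ {r} (w : Vec Bool r) (L : List (Vec Bool r)) → Dec (w ∈ₗ L)
_∈ₗ?_ = DecMembership._∈?_ _≟ᵥ_

Independent : ∀ {r m} → Vec (Vec Bool r) m → Subset m → Set
Independent [] [] = ⊤
Independent (w ∷ V) (inside ∷ X) = w ∉ₗ span V X × Independent V X
Independent (w ∷ V) (outside ∷ X) = Independent V X

independent? : ∀ {r m} (V : Vec (Vec Bool r) m) X → Dec (Independent V X)
independent? [] [] = yes tt
independent? (w ∷ V) (inside ∷ X) = ¬? (w ∈ₗ? span V X) ×-dec independent? V X
independent? (w ∷ V) (outside ∷ X) = independent? V X

independent⇒trivial-relation : ∀ {r m} (V : Vec (Vec Bool r) m) {X Y} →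
                               Independent V X → Y ⊆ X → lincomb V Y ≡ 𝟎 → Y ≡ 𝟎
independent⇒trivial-relation [] {[]} {[]} _ _ _ = refl
independent⇒trivial-relation (w ∷ V) {inside ∷ X} {inside ∷ Y} (w∉span , _) Y⊆X w+VY≡0 =
  ⊥-elim (w∉span (subst (_∈ₗ span V X) (sym (F₂.inverseˡ-unique w _ w+VY≡0)) (∈-span⁺ V (drop-∷-⊆ Y⊆X))))
independent⇒trivial-relation (w ∷ V) {inside ∷ X} {outside ∷ Y} (_ , indep) Y⊆X VY≡0 =
  cong (outside ∷_) (independent⇒trivial-relation V indep (drop-∷-⊆ Y⊆X) VY≡0)
independent⇒trivial-relation (w ∷ V) {outside ∷ X} {inside ∷ Y} _ Y⊆X _ with () ← Y⊆X here
independent⇒trivial-relation (w ∷ V) {outside ∷ X} {outside ∷ Y} indep Y⊆X VY≡0 =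
  cong (outside ∷_) (independent⇒trivial-relation V indep (drop-∷-⊆ Y⊆X) VY≡0)

independent-antimono : ∀ {r m} (V : Vec (Vec Bool r) m) {A B} → A ⊆ B → Independent V B → Independent V A
independent-antimono [] {[]} {[]} _ _ = tt
independent-antimono (w ∷ V) {inside ∷ A} {inside ∷ B} A⊆B (w∉span , indep) =
  w∉span ∘ span-mono V (drop-∷-⊆ A⊆B) , independent-antimono V (drop-∷-⊆ A⊆B) indep
independent-antimono (w ∷ V) {inside ∷ A} {outside ∷ B} A⊆B _ with () ← A⊆B here
independent-antimono (w ∷ V) {outside ∷ A} {inside ∷ B} A⊆B (_ , indep) = independent-antimono V (drop-∷-⊆ A⊆B) indep
independent-antimono (w ∷ V) {outside ∷ A} {outside ∷ B} A⊆B indep = independent-antimono V (drop-∷-⊆ A⊆B) indep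

independent⇒unique-span : ∀ {r m} (V : Vec (Vec Bool r) m) X → Independent V X → Unique (span V X)
independent⇒unique-span [] [] _ = [] ∷ []
independent⇒unique-span (w ∷ V) (inside ∷ X) (w∉span , indep) =
  Unique.++⁺ unique (Unique.map⁺ (F₂.∙-cancelˡ w _ _) unique) disjoint
  where
  unique : Unique (span V X)
  unique = independent⇒unique-span V X indep
  disjoint : Disjoint (span V X) (map (w ⊕_) (span V X))
  disjoint (v∈span , v∈w⊕span) with s , s∈span , refl ← ∈-map⁻ (w ⊕_) v∈w⊕span =
    w∉span (subst (_∈ₗ span V X) (F₂.//-rightDividesʳ s w) (span-⊕ V X v∈span s∈span))
independent⇒unique-span (w ∷ V) (outside ∷ X) indep = independent⇒unique-span V X indep

∑-≟ᵥ : ∀ {r} (x : Vec Bool r) → ∑[ w ← subsets r ] ⟦ does (w ≟ᵥ x) ⟧ ≡ 1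
∑-≟ᵥ [] = refl
∑-≟ᵥ {suc r} (inside ∷ x) =
  trans (∑-subsets-suc r (λ w → ⟦ does (w ≟ᵥ (inside ∷ x)) ⟧)) (cong₂ _+_ (∑-≟ᵥ x) (∑-zero (subsets r)))
∑-≟ᵥ {suc r} (outside ∷ x) =
  trans (∑-subsets-suc r (λ w → ⟦ does (w ≟ᵥ (outside ∷ x)) ⟧)) (cong₂ _+_ (∑-zero (subsets r)) (∑-≟ᵥ x))

∑-∈-unique : ∀ {r} {L : List (Vec Bool r)} → Unique L → ∑[ w ← subsets r ] ⟦ does (w ∈ₗ? L) ⟧ ≡ length L
∑-∈-unique {r} {[]} _ = ∑-zero (subsets r)
∑-∈-unique {r} {x ∷ L} (x≢L ∷ unique) = begin
  ∑[ w ← subsets r ] ⟦ does (w ≟ᵥ x) ∨ does (w ∈ₗ? L) ⟧                ≡⟨ ∑-cong (subsets r) split ⟩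
  ∑[ w ← subsets r ] (⟦ does (w ≟ᵥ x) ⟧ + ⟦ does (w ∈ₗ? L) ⟧)          ≡⟨ ∑-+ (subsets r) _ _ ⟩
  ∑[ w ← subsets r ] ⟦ does (w ≟ᵥ x) ⟧ + ∑[ w ← subsets r ] ⟦ does (w ∈ₗ? L) ⟧
                                                                      ≡⟨ cong₂ _+_ (∑-≟ᵥ x) (∑-∈-unique unique) ⟩
  suc (length L)                                                      ∎
  where
  open ≡-Reasoning
  split : ∀ w → ⟦ does (w ≟ᵥ x) ∨ does (w ∈ₗ? L) ⟧ ≡ ⟦ does (w ≟ᵥ x) ⟧ + ⟦ does (w ∈ₗ? L) ⟧
  split w with w ≟ᵥ x
  ... | yes refl rewrite dec-false (w ∈ₗ? L) (All¬⇒¬Any x≢L) = refl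
  ... | no _ = refl

unique⇒length≤2^r : ∀ {r} {L : List (Vec Bool r)} → Unique L → length L ≤ 2 ^ r
unique⇒length≤2^r {r} {L} unique = begin
  length L                               ≡⟨ ∑-∈-unique unique ⟨
  ∑[ w ← subsets r ] ⟦ does (w ∈ₗ? L) ⟧  ≤⟨ ∑-mono-≤ (subsets r) (λ w → ⟦⟧≤1 (does (w ∈ₗ? L))) ⟩
  ∑[ w ← subsets r ] 1                   ≡⟨ length≡∑1 (subsets r) ⟨
  length (subsets r)                     ≡⟨ length-subsets r ⟩
  2 ^ r                                  ∎
  where open ≤-Reasoning

∑-∉-span : ∀ {r m} (V : Vec (Vec Bool r) m) X → Independent V X →
           ∑[ w ← subsets r ] ⟦ not (does (w ∈ₗ? span V X)) ⟧ ≡ 2 ^ r ∸ 2 ^ ∣ X ∣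
∑-∉-span {r} V X indep = begin
  ∑ (subsets r) outside-span                                                ≡⟨ m+n∸n≡m _ (∑ (subsets r) inside-span) ⟨
  ∑ (subsets r) outside-span + ∑ (subsets r) inside-span ∸ ∑ (subsets r) inside-span
                                                                            ≡⟨ cong₂ _∸_ partition (trans (∑-∈-unique unique) (length-span V X)) ⟩
  2 ^ r ∸ 2 ^ ∣ X ∣                                                         ∎
  where
  open ≡-Reasoning
  inside-span outside-span : Vec Bool r → ℕ
  inside-span w = ⟦ does (w ∈ₗ? span V X) ⟧
  outside-span w = ⟦ not (does (w ∈ₗ? span V X)) ⟧
  unique : Unique (span V X)
  unique = independent⇒unique-span V X indep
  partition : ∑ (subsets r) outside-span + ∑ (subsets r) inside-span ≡ 2 ^ r
  partition = begin
    ∑ (subsets r) outside-span + ∑ (subsets r) inside-span       ≡⟨ ∑-+ (subsets r) outside-span inside-span ⟨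
    ∑[ w ← subsets r ] (outside-span w + inside-span w)          ≡⟨ ∑-cong (subsets r) (λ w → ⟦not⟧+⟦⟧ (does (w ∈ₗ? span V X))) ⟩
    ∑[ w ← subsets r ] 1                                         ≡⟨ length≡∑1 (subsets r) ⟨
    length (subsets r)                                           ≡⟨ length-subsets r ⟩
    2 ^ r                                                        ∎

∑-independent-extensions : ∀ {r m} (V : Vec (Vec Bool r) m) X →
  ∑[ u ← subsets r ] ⟦ not (does (u ∈ₗ? span V X)) ∧ does (independent? V X) ⟧ ≡ (2 ^ r ∸ 2 ^ ∣ X ∣) * ⟦ does (independent? V X) ⟧
∑-independent-extensions {r} V X with independent? V X
... | yes indep = trans (∑-cong (subsets r) (λ u → cong ⟦_⟧ (∧-identityʳ _)))
                        (trans (∑-∉-span V X indep) (sym (*-identityʳ _)))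
... | no _ = trans (∑-cong (subsets r) (λ u → cong ⟦_⟧ (∧-zeroʳ _)))
                   (trans (∑-zero (subsets r)) (sym (*-zeroʳ (2 ^ r ∸ 2 ^ ∣ X ∣))))

basis-spans : ∀ {r m} (V : Vec (Vec Bool r) m) {B} → Independent V B → ∣ B ∣ ≡ r → ∀ u → u ∈ₗ span V B
basis-spans {r} V {B} indep ∣B∣≡r u with u ∈ₗ? span V B
... | yes u∈span = u∈span
... | no u∉span = ⊥-elim (<⇒≱ (^-monoʳ-< 2 (s≤s (s≤s z≤n)) (n<1+n r)) (begin
  2 ^ suc r                                   ≡⟨ cong (λ k → 2 ^ suc k) ∣B∣≡r ⟨
  2 ^ suc ∣ B ∣                               ≡⟨ length-span (u ∷ V) (inside ∷ B) ⟨
  length (span (u ∷ V) (inside ∷ B))          ≤⟨ unique⇒length≤2^r (independent⇒unique-span (u ∷ V) (inside ∷ B) (u∉span , indep)) ⟩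
  2 ^ r                                       ∎))
  where open ≤-Reasoning

families : ∀ r m → List (Vec (Vec Bool r) m)
families r m = allVecs (subsets r) m

length-families : ∀ r m → length (families r m) ≡ (2 ^ r) ^ m
length-families r m = trans (length-allVecs (subsets r) m) (cong (_^ m) (length-subsets r))

#independent : ∀ r m → Subset m → ℕ
#independent r m X = ∑[ V ← families r m ] ⟦ does (independent? V X) ⟧

#independent-outside : ∀ r m X → #independent r (suc m) (outside ∷ X) ≡ 2 ^ r * #independent r m X
#independent-outside r m X = begin
  #independent r (suc m) (outside ∷ X)             ≡⟨ ∑-allVecs-suc (subsets r) m _ ⟩
  ∑[ u ← subsets r ] #independent r m X            ≡⟨ ∑-constant-on (subsets r) _ (λ _ _ → refl) ⟩
  length (subsets r) * #independent r m X          ≡⟨ cong (_* #independent r m X) (length-subsets r) ⟩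
  2 ^ r * #independent r m X                       ∎
  where open ≡-Reasoning

#independent-inside : ∀ r m X → #independent r (suc m) (inside ∷ X) ≡ (2 ^ r ∸ 2 ^ ∣ X ∣) * #independent r m X
#independent-inside r m X = begin
  #independent r (suc m) (inside ∷ X)
    ≡⟨ ∑-allVecs-suc (subsets r) m _ ⟩
  ∑[ u ← subsets r ] ∑[ V ← families r m ] ⟦ not (does (u ∈ₗ? span V X)) ∧ does (independent? V X) ⟧
    ≡⟨ ∑-swap (subsets r) (families r m) _ ⟩
  ∑[ V ← families r m ] ∑[ u ← subsets r ] ⟦ not (does (u ∈ₗ? span V X)) ∧ does (independent? V X) ⟧
    ≡⟨ ∑-cong (families r m) (λ V → ∑-independent-extensions V X) ⟩
  ∑[ V ← families r m ] ((2 ^ r ∸ 2 ^ ∣ X ∣) * ⟦ does (independent? V X) ⟧)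
    ≡⟨ ∑-*ˡ (families r m) (2 ^ r ∸ 2 ^ ∣ X ∣) (λ V → ⟦ does (independent? V X) ⟧) ⟩
  (2 ^ r ∸ 2 ^ ∣ X ∣) * #independent r m X
    ∎
  where open ≡-Reasoning

-- The number ∏_{j<k} (2ʳ − 2ʲ) of linearly independent k-tuples in F₂ʳ.
frames : ℕ → ℕ → ℕ
frames r zero = 1
frames r (suc k) = frames r k * (2 ^ r ∸ 2 ^ k)

#independent-frames : ∀ r m X → #independent r m X * (2 ^ r) ^ ∣ X ∣ ≡ (2 ^ r) ^ m * frames r ∣ X ∣
#independent-frames r zero [] = refl
#independent-frames r (suc m) (outside ∷ X) = begin
  #independent r (suc m) (outside ∷ X) * (2 ^ r) ^ ∣ X ∣   ≡⟨ cong (_* (2 ^ r) ^ ∣ X ∣) (#independent-outside r m X) ⟩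
  2 ^ r * #independent r m X * (2 ^ r) ^ ∣ X ∣             ≡⟨ *-assoc (2 ^ r) _ _ ⟩
  2 ^ r * (#independent r m X * (2 ^ r) ^ ∣ X ∣)           ≡⟨ cong (2 ^ r *_) (#independent-frames r m X) ⟩
  2 ^ r * ((2 ^ r) ^ m * frames r ∣ X ∣)                   ≡⟨ *-assoc (2 ^ r) _ _ ⟨
  (2 ^ r) ^ suc m * frames r ∣ X ∣                         ∎
  where open ≡-Reasoning
#independent-frames r (suc m) (inside ∷ X) = begin
  #independent r (suc m) (inside ∷ X) * (2 ^ r) ^ suc ∣ X ∣     ≡⟨ cong (_* (2 ^ r) ^ suc ∣ X ∣) (#independent-inside r m X) ⟩
  c * #independent r m X * (2 ^ r * (2 ^ r) ^ ∣ X ∣)           ≡⟨ regroup c (#independent r m X) (2 ^ r) ((2 ^ r) ^ ∣ X ∣) ⟩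
  2 ^ r * (#independent r m X * (2 ^ r) ^ ∣ X ∣) * c           ≡⟨ cong (λ k → 2 ^ r * k * c) (#independent-frames r m X) ⟩
  2 ^ r * ((2 ^ r) ^ m * frames r ∣ X ∣) * c                   ≡⟨ regroup′ (2 ^ r) ((2 ^ r) ^ m) (frames r ∣ X ∣) c ⟩
  (2 ^ r) ^ suc m * frames r (suc ∣ X ∣)                       ∎
  where
  open ≡-Reasoning
  c : ℕ
  c = 2 ^ r ∸ 2 ^ ∣ X ∣
  regroup : ∀ c i q p → c * i * (q * p) ≡ q * (i * p) * c
  regroup = solve-∀
  regroup′ : ∀ q p f c → q * (p * f) * c ≡ q * p * (f * c)
  regroup′ = solve-∀

frames-suc : ∀ r k → frames (suc r) (suc k) ≡ (2 ^ suc r ∸ 1) * (2 ^ k * frames r k)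
frames-suc r zero = *-comm 1 (2 ^ suc r ∸ 1)
frames-suc r (suc k) = begin
  frames (suc r) (suc k) * (2 ^ suc r ∸ 2 ^ suc k)               ≡⟨ cong₂ _*_ (frames-suc r k) (sym (*-distribˡ-∸ 2 (2 ^ r) (2 ^ k))) ⟩
  (g * (2 ^ k * frames r k)) * (2 * (2 ^ r ∸ 2 ^ k))            ≡⟨ regroup g (2 ^ k) (frames r k) (2 ^ r ∸ 2 ^ k) ⟩
  g * ((2 * 2 ^ k) * (frames r k * (2 ^ r ∸ 2 ^ k)))            ∎
  where
  open ≡-Reasoning
  g : ℕ
  g = 2 ^ suc r ∸ 1
  regroup : ∀ g p f d → (g * (p * f)) * (2 * d) ≡ g * ((2 * p) * (f * d))
  regroup = solve-∀

^-distribʳ-* : ∀ a b n → (a * b) ^ n ≡ a ^ n * b ^ n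
^-distribʳ-* a b zero = refl
^-distribʳ-* a b (suc n) = trans (cong (a * b *_) (^-distribʳ-* a b n)) (regroup a b (a ^ n) (b ^ n))
  where
  regroup : ∀ a b x y → a * b * (x * y) ≡ a * x * (b * y)
  regroup = solve-∀

frames-diagonal : ∀ r → frames r r * 2 ^ tri r ≡ (2 ^ r) ^ r * prodNum r
frames-diagonal zero = refl
frames-diagonal (suc r) = begin
  frames (suc r) (suc r) * 2 ^ (tri r + suc r)
    ≡⟨ cong₂ _*_ (frames-suc r r) (^-distribˡ-+-* 2 (tri r) (suc r)) ⟩
  g * (2 ^ r * frames r r) * (2 ^ tri r * 2 ^ suc r)
    ≡⟨ regroup g (2 ^ r) (frames r r) (2 ^ tri r) (2 ^ suc r) ⟩
  2 ^ suc r * 2 ^ r * (frames r r * 2 ^ tri r) * g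
    ≡⟨ cong (λ k → 2 ^ suc r * 2 ^ r * k * g) (frames-diagonal r) ⟩
  2 ^ suc r * 2 ^ r * ((2 ^ r) ^ r * prodNum r) * g
    ≡⟨ regroup′ (2 ^ suc r) (2 ^ r) ((2 ^ r) ^ r) (prodNum r) g ⟩
  2 ^ suc r * (2 ^ r * (2 ^ r) ^ r) * (prodNum r * g)
    ≡⟨ cong (λ k → 2 ^ suc r * k * (prodNum r * g)) (^-distribʳ-* 2 (2 ^ r) r) ⟨
  (2 ^ suc r) ^ suc r * prodNum (suc r)
    ∎
  where
  open ≡-Reasoning
  g : ℕ
  g = 2 ^ suc r ∸ 1
  regroup : ∀ g p f t s → g * (p * f) * (t * s) ≡ s * p * (f * t) * g
  regroup = solve-∀
  regroup′ : ∀ s p q n g → s * p * (q * n) * g ≡ s * (p * q) * (n * g)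
  regroup′ = solve-∀

prodNum-positive : ∀ K → 0 < prodNum K
prodNum-positive zero = s≤s z≤n
prodNum-positive (suc K) = *-mono-< (prodNum-positive K) (m<n⇒0<n∸m (^-monoʳ-< 2 (s≤s (s≤s z≤n)) {0} {suc K} (s≤s z≤n)))

-- As ∏_{i≤K+1} (1 − 2⁻ⁱ) < ∏_{i≤K} (1 − 2⁻ⁱ), a non-strict bound at K is strict at K + 1.
≤⇒GtHalfC : ∀ K {x y} → 0 < y → prodNum K * y ≤ 2 * 2 ^ tri K * x → GtHalfC x y
≤⇒GtHalfC K {x} {y} y>0 ≤-bound = suc K , (begin-strict
  prodNum K * (g ∸ 1) * y          ≡⟨ regroup (prodNum K) (g ∸ 1) y ⟩
  (g ∸ 1) * (prodNum K * y)        <⟨ *-monoˡ-< (prodNum K * y) {{>-nonZero (*-mono-< (prodNum-positive K) y>0)}} (∸-monoʳ-< {o = 0} (s≤s z≤n) (m^n>0 2 (suc K))) ⟩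
  g * (prodNum K * y)              ≤⟨ *-monoʳ-≤ g ≤-bound ⟩
  g * (2 * 2 ^ tri K * x)          ≡⟨ regroup′ g (2 ^ tri K) x ⟩
  2 * (2 ^ tri K * g) * x          ≡⟨ cong (λ k → 2 * k * x) (^-distribˡ-+-* 2 (tri K) (suc K)) ⟨
  2 * 2 ^ tri (suc K) * x          ∎)
  where
  open ≤-Reasoning
  g : ℕ
  g = 2 ^ suc K
  regroup : ∀ p h y → p * h * y ≡ h * (p * y)
  regroup = solve-∀
  regroup′ : ∀ g t x → g * (2 * t * x) ≡ 2 * (t * g) * x
  regroup′ = solve-∀

IsBasis : ∀ {r m} → Vec (Vec Bool r) m → Subset m → Set
IsBasis {r} V X = Independent V X × ∣ X ∣ ≡ r

-- Entry 0 of V plays the role of u: X is kept when (V_{1+i})_{i∈X} is a basis, or when it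
-- becomes one after adding V₀.
Selected : ∀ {r n} → Vec (Vec Bool r) (suc n) → Subset n → Set
Selected V X = IsBasis V (outside ∷ X) ⊎ IsBasis V (inside ∷ X)

selected? : ∀ {r n} (V : Vec (Vec Bool r) (suc n)) X → Dec (Selected V X)
selected? {r} V X = (independent? V (outside ∷ X) ×-dec (∣ X ∣ ≟ r)) ⊎-dec (independent? V (inside ∷ X) ×-dec (suc ∣ X ∣ ≟ r))

selected : ∀ {r n} → Vec (Vec Bool r) (suc n) → Subset n → Bool
selected V X = does (selected? V X)

T-does⁻ : ∀ {P : Set} (d : Dec P) → T (does d) → P
T-does⁻ (yes p) _ = p

selected-layer : ∀ {r n} (V : Vec (Vec Bool r) (suc n)) → IsLayerVertexSet r (selected V)
selected-layer V X X-selected with T-does⁻ (selected? V X) X-selected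
... | inj₁ (_ , ∣X∣≡r) = inj₂ ∣X∣≡r
... | inj₂ (_ , 1+∣X∣≡r) = inj₁ (cong (_∸ 1) 1+∣X∣≡r)

module _ {k n : ℕ} (u : Vec Bool (suc k)) (V : Vec (Vec Bool (suc k)) n) where

  selected-bottom : ∀ {A} → ∣ A ∣ ≡ k → Selected (u ∷ V) A ⇔ Independent (u ∷ V) (inside ∷ A)
  selected-bottom ∣A∣≡k = mk⇔
    (λ { (inj₁ (_ , ∣A∣≡1+k)) → ⊥-elim (<⇒≢ (n<1+n k) (trans (sym ∣A∣≡k) ∣A∣≡1+k)) ; (inj₂ (indep , _)) → indep })
    (λ indep → inj₂ (indep , cong suc ∣A∣≡k))

  selected-top : ∀ {B} → ∣ B ∣ ≡ suc k → Selected (u ∷ V) B ⇔ Independent V B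
  selected-top ∣B∣≡1+k = mk⇔
    (λ { (inj₁ (indep , _)) → indep ; (inj₂ (_ , 2+∣B∣≡1+k)) → ⊥-elim (<⇒≢ (n<1+n k) (trans (sym (suc-injective 2+∣B∣≡1+k)) ∣B∣≡1+k)) })
    (λ indep → inj₁ (indep , ∣B∣≡1+k))

2^[1+k]∸2^k≡2^k : ∀ k → 2 ^ suc k ∸ 2 ^ k ≡ 2 ^ k
2^[1+k]∸2^k≡2^k k = trans (m+n∸m≡n (2 ^ k) (2 ^ k + 0)) (+-identityʳ (2 ^ k))

∑-kept-extensions : ∀ {k n} (V : Vec (Vec Bool (suc k)) n) {A B} → LEdge (suc k) A B →
  ∑[ u ← subsets (suc k) ] ⟦ selected (u ∷ V) A ∧ selected (u ∷ V) B ⟧ ≡ 2 ^ k * ⟦ does (independent? V B) ⟧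
∑-kept-extensions {k} V {A} {B} (∣A∣≡k , ∣B∣≡1+k , A⊆B) = begin
  ∑[ u ← subsets (suc k) ] ⟦ selected (u ∷ V) A ∧ selected (u ∷ V) B ⟧
    ≡⟨ ∑-cong (subsets (suc k)) (λ u → cong₂ (λ a b → ⟦ a ∧ b ⟧)
         (does-⇔ (selected-bottom u V ∣A∣≡k) (selected? (u ∷ V) A) (independent? (u ∷ V) (inside ∷ A)))
         (does-⇔ (selected-top u V ∣B∣≡1+k) (selected? (u ∷ V) B) (independent? V B))) ⟩
  ∑[ u ← subsets (suc k) ] ⟦ (not (does (u ∈ₗ? span V A)) ∧ does (independent? V A)) ∧ does (independent? V B) ⟧
    ≡⟨ count ⟩
  2 ^ k * ⟦ does (independent? V B) ⟧
    ∎
  where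
  open ≡-Reasoning
  count : ∑[ u ← subsets (suc k) ] ⟦ (not (does (u ∈ₗ? span V A)) ∧ does (independent? V A)) ∧ does (independent? V B) ⟧
          ≡ 2 ^ k * ⟦ does (independent? V B) ⟧
  count with independent? V B
  ... | yes indep-B = begin
    ∑[ u ← subsets (suc k) ] ⟦ (not (does (u ∈ₗ? span V A)) ∧ does (independent? V A)) ∧ true ⟧
      ≡⟨ ∑-cong (subsets (suc k)) (λ u → cong ⟦_⟧ (∧-identityʳ _)) ⟩
    ∑[ u ← subsets (suc k) ] ⟦ not (does (u ∈ₗ? span V A)) ∧ does (independent? V A) ⟧
      ≡⟨ ∑-independent-extensions V A ⟩
    (2 ^ suc k ∸ 2 ^ ∣ A ∣) * ⟦ does (independent? V A) ⟧
      ≡⟨ cong₂ (λ a b → (2 ^ suc k ∸ 2 ^ a) * ⟦ b ⟧) ∣A∣≡k (dec-true (independent? V A) (independent-antimono V A⊆B indep-B)) ⟩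
    (2 ^ suc k ∸ 2 ^ k) * 1
      ≡⟨ cong (_* 1) (2^[1+k]∸2^k≡2^k k) ⟩
    2 ^ k * 1
      ∎
  ... | no _ = trans (∑-cong (subsets (suc k)) (λ u → cong ⟦_⟧ (∧-zeroʳ _)))
                     (trans (∑-zero (subsets (suc k))) (sym (*-zeroʳ (2 ^ k))))

#kept : ∀ {k n} {A B : Subset n} → LEdge (suc k) A B →
  ∑[ V ← families (suc k) (suc n) ] ⟦ selected V A ∧ selected V B ⟧ ≡ 2 ^ k * #independent (suc k) n B
#kept {k} {n} {A} {B} edge = begin
  ∑[ V ← families (suc k) (suc n) ] ⟦ selected V A ∧ selected V B ⟧
    ≡⟨ ∑-allVecs-suc (subsets (suc k)) n _ ⟩
  ∑[ u ← subsets (suc k) ] ∑[ V ← families (suc k) n ] ⟦ selected (u ∷ V) A ∧ selected (u ∷ V) B ⟧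
    ≡⟨ ∑-swap (subsets (suc k)) (families (suc k) n) _ ⟩
  ∑[ V ← families (suc k) n ] ∑[ u ← subsets (suc k) ] ⟦ selected (u ∷ V) A ∧ selected (u ∷ V) B ⟧
    ≡⟨ ∑-cong (families (suc k) n) (λ V → ∑-kept-extensions V edge) ⟩
  ∑[ V ← families (suc k) n ] (2 ^ k * ⟦ does (independent? V B) ⟧)
    ≡⟨ ∑-*ˡ (families (suc k) n) (2 ^ k) (λ V → ⟦ does (independent? V B) ⟧) ⟩
  2 ^ k * #independent (suc k) n B
    ∎
  where open ≡-Reasoning

∑-eInduced : ∀ k n →
  (2 ^ suc k) ^ suc k * ∑[ V ← families (suc k) (suc n) ] eInduced n (suc k) (selected V)
    ≡ eLayer n (suc k) * (2 ^ k * ((2 ^ suc k) ^ n * frames (suc k) (suc k)))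
∑-eInduced k n = begin
  q ^ r * ∑[ V ← FF ] eInduced n r (selected V)
    ≡⟨ cong (q ^ r *_) (∑-cong FF (λ V → length-filter-T? E (kept V))) ⟩
  q ^ r * ∑[ V ← FF ] ∑[ e ← E ] ⟦ kept V e ⟧
    ≡⟨ cong (q ^ r *_) (∑-swap FF E (λ V e → ⟦ kept V e ⟧)) ⟩
  q ^ r * ∑[ e ← E ] ∑[ V ← FF ] ⟦ kept V e ⟧
    ≡⟨ ∑-*ˡ E (q ^ r) (λ e → ∑[ V ← FF ] ⟦ kept V e ⟧) ⟨
  ∑[ e ← E ] (q ^ r * ∑[ V ← FF ] ⟦ kept V e ⟧)
    ≡⟨ ∑-constant-on E _ per-edge ⟩
  length E * (2 ^ k * (q ^ n * frames r r))
    ∎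
  where
  open ≡-Reasoning
  r q : ℕ
  r = suc k
  q = 2 ^ r
  FF : List (Vec (Vec Bool r) (suc n))
  FF = families r (suc n)
  E : List (Subset n × Subset n)
  E = layerEdges n r
  kept : Vec (Vec Bool r) (suc n) → Subset n × Subset n → Bool
  kept V (A , B) = selected V A ∧ selected V B
  per-edge : ∀ e → e ∈ₗ E → q ^ r * ∑[ V ← FF ] ⟦ kept V e ⟧ ≡ 2 ^ k * (q ^ n * frames r r)
  per-edge (A , B) e∈E
    with (∣A∣≡k , ∣B∣≡r , A⊆B) ← proj₂ (∈-filter⁻ (λ e → LEdge? r (proj₁ e) (proj₂ e)) {xs = cartesianProduct (subsets n) (subsets n)} e∈E)
    = begin
    q ^ r * ∑[ V ← FF ] ⟦ selected V A ∧ selected V B ⟧   ≡⟨ cong (q ^ r *_) (#kept (∣A∣≡k , ∣B∣≡r , A⊆B)) ⟩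
    q ^ r * (2 ^ k * #independent r n B)                  ≡⟨ regroup (q ^ r) (2 ^ k) (#independent r n B) ⟩
    2 ^ k * (#independent r n B * q ^ r)                  ≡⟨ cong (λ j → 2 ^ k * (#independent r n B * q ^ j)) ∣B∣≡r ⟨
    2 ^ k * (#independent r n B * q ^ ∣ B ∣)              ≡⟨ cong (2 ^ k *_) (#independent-frames r n B) ⟩
    2 ^ k * (q ^ n * frames r ∣ B ∣)                      ≡⟨ cong (λ j → 2 ^ k * (q ^ n * frames r j)) ∣B∣≡r ⟩
    2 ^ k * (q ^ n * frames r r)                          ∎
    where
    regroup : ∀ s a i → s * (a * i) ≡ a * (i * s)
    regroup = solve-∀

density-bound : ∀ k n {e E T} →
  (2 ^ suc k) ^ suc k * T ≡ E * (2 ^ k * ((2 ^ suc k) ^ n * frames (suc k) (suc k))) →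
  T ≤ (2 ^ suc k) ^ suc n * e →
  prodNum (suc k) * E ≤ 2 * 2 ^ tri (suc k) * e
density-bound k n {e} {E} {T} total T≤ = *-cancelˡ-≤ c {{>-nonZero c>0}} (begin
  c * (prodNum r * E)                            ≡⟨ regroup (2 ^ k) (q ^ n) (q ^ r) (prodNum r) E ⟩
  E * 2 ^ k * q ^ n * (q ^ r * prodNum r)        ≡⟨ cong (E * 2 ^ k * q ^ n *_) (frames-diagonal r) ⟨
  E * 2 ^ k * q ^ n * (frames r r * 2 ^ tri r)   ≡⟨ regroup′ E (2 ^ k) (q ^ n) (frames r r) (2 ^ tri r) ⟩
  E * (2 ^ k * (q ^ n * frames r r)) * 2 ^ tri r ≡⟨ cong (_* 2 ^ tri r) total ⟨
  q ^ r * T * 2 ^ tri r                          ≤⟨ *-monoˡ-≤ (2 ^ tri r) (*-monoʳ-≤ (q ^ r) T≤) ⟩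
  q ^ r * (q ^ suc n * e) * 2 ^ tri r            ≡⟨ regroup″ (2 ^ k) (q ^ n) (q ^ r) e (2 ^ tri r) ⟩
  c * (2 * 2 ^ tri r * e)                        ∎)
  where
  open ≤-Reasoning
  r q c : ℕ
  r = suc k
  q = 2 ^ r
  c = 2 ^ k * q ^ n * q ^ r
  c>0 : 0 < c
  c>0 = *-mono-< (*-mono-< (m^n>0 2 k) (m^n>0 q {{m^n≢0 2 r}} n)) (m^n>0 q {{m^n≢0 2 r}} r)
  regroup : ∀ a p s f E → a * p * s * (f * E) ≡ E * a * p * (s * f)
  regroup = solve-∀
  regroup′ : ∀ E a p f t → E * a * p * (f * t) ≡ E * (a * (p * f)) * t
  regroup′ = solve-∀
  regroup″ : ∀ a p s e t → s * ((2 * a) * p * e) * t ≡ a * p * s * (2 * t * e)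
  regroup″ = solve-∀

initial : ∀ {n} → ℕ → Subset n
initial zero = ∅
initial {zero} (suc j) = []
initial {suc n} (suc j) = inside ∷ initial j

∣initial∣ : ∀ {n} j → j ≤ n → ∣ initial {n} j ∣ ≡ j
∣initial∣ {n} zero _ = ∣⊥∣≡0 n
∣initial∣ {suc n} (suc j) (s≤s j≤n) = cong suc (∣initial∣ j j≤n)

initial-⊆ : ∀ {n} j → initial {n} j ⊆ initial (suc j)
initial-⊆ zero = ⊥⊆
initial-⊆ {zero} (suc j) = ⊆-refl
initial-⊆ {suc n} (suc j) = in⊆in (initial-⊆ j)

eLayer-positive : ∀ {k n} → suc k ≤ n → 0 < eLayer n (suc k)
eLayer-positive {k} {n} 1+k≤n = nonempty (∈-filter⁺ (λ e → LEdge? (suc k) (proj₁ e) (proj₂ e))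
  (∈-cartesianProduct⁺ (∈-subsets (initial k)) (∈-subsets (initial (suc k))))
  (∣initial∣ k (≤-trans (n≤1+n k) 1+k≤n) , ∣initial∣ (suc k) 1+k≤n , initial-⊆ k))
  where
  nonempty : ∀ {A : Set} {x : A} {xs} → x ∈ₗ xs → 0 < length xs
  nonempty (hereₗ _) = s≤s z≤n
  nonempty (thereₗ _) = s≤s z≤n

⊆∧∣∣≤⇒≡ : ∀ {m} {X Y : Subset m} → X ⊆ Y → ∣ Y ∣ ≤ ∣ X ∣ → X ≡ Y
⊆∧∣∣≤⇒≡ {X = X} {Y} X⊆Y ∣Y∣≤∣X∣ = ⊆-antisym X⊆Y Y⊆X
  where
  Y⊆X : Y ⊆ X
  Y⊆X {i} i∈Y with i ∈? X
  ... | yes i∈X = i∈X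
  ... | no i∉X = ⊥-elim (<⇒≱ (p⊂q⇒∣p∣<∣q∣ (X⊆Y , i , i∈Y , i∉X)) ∣Y∣≤∣X∣)

one-point-extension : ∀ {m} {X Y : Subset m} → X ⊆ Y → ∣ Y ∣ ≡ suc ∣ X ∣ → ∃ λ y → Y ⊆ X ∪ ⁅ y ⁆
one-point-extension {X = inside ∷ X} {inside ∷ Y} X⊆Y ∣Y∣≡
  with y , Y⊆ ← one-point-extension (drop-∷-⊆ X⊆Y) (suc-injective ∣Y∣≡) = suc y , in⊆in Y⊆
one-point-extension {X = outside ∷ X} {outside ∷ Y} X⊆Y ∣Y∣≡
  with y , Y⊆ ← one-point-extension (drop-∷-⊆ X⊆Y) ∣Y∣≡ = suc y , out⊆ Y⊆
one-point-extension {X = inside ∷ X} {outside ∷ Y} X⊆Y _ with () ← X⊆Y here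
one-point-extension {X = outside ∷ X} {inside ∷ Y} X⊆Y ∣Y∣≡ = zero , in⊆in Y⊆X∪∅
  where
  Y⊆X∪∅ : Y ⊆ X ∪ ∅
  Y⊆X∪∅ = subst (_⊆ X ∪ ∅) (⊆∧∣∣≤⇒≡ (drop-∷-⊆ X⊆Y) (≤-reflexive (suc-injective ∣Y∣≡))) (p⊆p∪q ∅)

∈-∪⁅⁆⁻ : ∀ {m} (X : Subset m) y {i} → i ∈ X ∪ ⁅ y ⁆ → i ∈ X ⊎ i ≡ y
∈-∪⁅⁆⁻ X y i∈ = Sum.map₂ (x∈⁅y⁆⇒x≡y y) (x∈p∪q⁻ X ⁅ y ⁆ i∈)

module _ {k n : ℕ} where

  edge-apex : ∀ {A B : Subset n} → LEdge (suc k) A B → ∃ λ y → B ⊆ A ∪ ⁅ y ⁆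
  edge-apex (∣A∣≡k , ∣B∣≡1+k , A⊆B) = one-point-extension A⊆B (trans ∣B∣≡1+k (cong suc (sym ∣A∣≡k)))

  distinct-edges-meet : ∀ {A B B' : Subset n} → LEdge (suc k) A B → LEdge (suc k) A B' → B ≢ B' →
                        ∀ {i} → i ∈ B → i ∈ B' → i ∈ A
  distinct-edges-meet {A} {B} {B'} AB@(_ , ∣B∣≡1+k , _) (_ , ∣B'∣≡1+k , A⊆B') B≢B' {i} i∈B i∈B' with i ∈? A
  ... | yes i∈A = i∈A
  ... | no i∉A with y , B⊆A∪y ← edge-apex AB =
    ⊥-elim (B≢B' (⊆∧∣∣≤⇒≡ B⊆B' (≤-reflexive (trans ∣B'∣≡1+k (sym ∣B∣≡1+k)))))
    where
    B⊆B' : B ⊆ B'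
    B⊆B' j∈B with ∈-∪⁅⁆⁻ A y (B⊆A∪y j∈B) | ∈-∪⁅⁆⁻ A y (B⊆A∪y i∈B)
    ... | inj₁ j∈A | _ = A⊆B' j∈A
    ... | inj₂ refl | inj₁ i∈A = ⊥-elim (i∉A i∈A)
    ... | inj₂ refl | inj₂ refl = i∈B'

  hexagon-apex : ∀ {B₁ A₁ B₂ A₂ B₃ A₃ : Subset n} →
    LEdge (suc k) A₁ B₁ → LEdge (suc k) A₁ B₂ → LEdge (suc k) A₂ B₂ →
    LEdge (suc k) A₂ B₃ → LEdge (suc k) A₃ B₃ → LEdge (suc k) A₃ B₁ → A₂ ≢ A₃ →
    ∃ λ y → B₂ ⊆ B₁ ∪ ⁅ y ⁆ × B₃ ⊆ B₁ ∪ ⁅ y ⁆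
  hexagon-apex {B₁} {A₁} {B₂} {A₂} {B₃} {A₃} (_ , _ , A₁⊆B₁) A₁B₂ (∣A₂∣≡k , _ , A₂⊆B₂) A₂B₃ (∣A₃∣≡k , _ , A₃⊆B₃) (_ , _ , A₃⊆B₁) A₂≢A₃
    with y , B₂⊆A₁∪y ← edge-apex A₁B₂ | t , B₃⊆A₂∪t ← edge-apex A₂B₃ = y , B₂⊆B₁∪y , B₃⊆B₁∪y
    where
    B₂⊆B₁∪y : B₂ ⊆ B₁ ∪ ⁅ y ⁆
    B₂⊆B₁∪y i∈B₂ with ∈-∪⁅⁆⁻ A₁ y (B₂⊆A₁∪y i∈B₂)
    ... | inj₁ i∈A₁ = p⊆p∪q ⁅ y ⁆ (A₁⊆B₁ i∈A₁)
    ... | inj₂ refl = x∈p∪q⁺ (inj₂ (x∈⁅x⁆ y))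
    -- If the apex t of B₃ over A₂ were new, A₃ ⊆ B₁ ∩ B₃ would lie inside A₂.
    t∈B₁∪y : t ∈ B₁ ∪ ⁅ y ⁆
    t∈B₁∪y with t ∈? (B₁ ∪ ⁅ y ⁆)
    ... | yes t∈ = t∈
    ... | no t∉ = ⊥-elim (A₂≢A₃ (sym (⊆∧∣∣≤⇒≡ A₃⊆A₂ (≤-reflexive (trans ∣A₂∣≡k (sym ∣A₃∣≡k))))))
      where
      A₃⊆A₂ : A₃ ⊆ A₂
      A₃⊆A₂ i∈A₃ with ∈-∪⁅⁆⁻ A₂ t (B₃⊆A₂∪t (A₃⊆B₃ i∈A₃))
      ... | inj₁ i∈A₂ = i∈A₂
      ... | inj₂ refl = ⊥-elim (t∉ (p⊆p∪q ⁅ y ⁆ (A₃⊆B₁ i∈A₃)))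
    B₃⊆B₁∪y : B₃ ⊆ B₁ ∪ ⁅ y ⁆
    B₃⊆B₁∪y i∈B₃ with ∈-∪⁅⁆⁻ A₂ t (B₃⊆A₂∪t i∈B₃)
    ... | inj₁ i∈A₂ = B₂⊆B₁∪y (A₂⊆B₂ i∈A₂)
    ... | inj₂ refl = t∈B₁∪y

lincomb-injective-∪⁅⁆ : ∀ {r m} (V : Vec (Vec Bool r) m) {X Y Z y} → Independent V X →
  Y ⊆ X ∪ ⁅ y ⁆ → Z ⊆ X ∪ ⁅ y ⁆ → lincomb V Y ≡ lincomb V Z → y ∉ Y ⊕ Z → Y ≡ Z
lincomb-injective-∪⁅⁆ V {X} {Y} {Z} {y} indep Y⊆ Z⊆ VY≡VZ y∉Y⊕Z =
  F₂.inverseˡ-unique Y Z (independent⇒trivial-relation V indep Y⊕Z⊆X V[Y⊕Z]≡𝟎)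
  where
  Y⊕Z⊆X : Y ⊕ Z ⊆ X
  Y⊕Z⊆X i∈Y⊕Z with ∈-∪⁅⁆⁻ X y (⊕-⊆ Y⊆ Z⊆ i∈Y⊕Z)
  ... | inj₁ i∈X = i∈X
  ... | inj₂ refl = ⊥-elim (y∉Y⊕Z i∈Y⊕Z)
  V[Y⊕Z]≡𝟎 : lincomb V (Y ⊕ Z) ≡ 𝟎
  V[Y⊕Z]≡𝟎 = trans (lincomb-⊕ V Y Z) (trans (cong (_⊕ lincomb V Z) VY≡VZ) (⊕-self (lincomb V Z)))

module _ {k n : ℕ} (u : Vec Bool (suc k)) (V : Vec (Vec Bool (suc k)) n) where

  no-selected-hexagon : ∀ {B₁ A₁ B₂ A₂ B₃ A₃ : Subset n} →
    LEdge (suc k) A₁ B₁ → LEdge (suc k) A₁ B₂ → LEdge (suc k) A₂ B₂ →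
    LEdge (suc k) A₂ B₃ → LEdge (suc k) A₃ B₃ → LEdge (suc k) A₃ B₁ →
    B₁ ≢ B₂ → B₂ ≢ B₃ → B₁ ≢ B₃ → A₂ ≢ A₃ →
    Independent V B₁ → Independent V B₂ → Independent V B₃ →
    u ∉ₗ span V A₁ → u ∉ₗ span V A₂ → u ∉ₗ span V A₃ → ⊥
  no-selected-hexagon {B₁} {A₁} {B₂} {A₂} {B₃} {A₃} A₁B₁ A₁B₂ A₂B₂ A₂B₃ A₃B₃ A₃B₁ B₁≢B₂ B₂≢B₃ B₁≢B₃ A₂≢A₃
                      indep₁ indep₂ indep₃ u∉A₁ u∉A₂ u∉A₃
    with y , B₂⊆ , B₃⊆ ← hexagon-apex A₁B₁ A₁B₂ A₂B₂ A₂B₃ A₃B₃ A₃B₁ A₂≢A₃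
       | Y₁ , Y₁⊆B₁ , VY₁≡u ← ∈-span⁻ V B₁ (basis-spans V indep₁ (proj₁ (proj₂ A₁B₁)) u)
       | Y₂ , Y₂⊆B₂ , VY₂≡u ← ∈-span⁻ V B₂ (basis-spans V indep₂ (proj₁ (proj₂ A₁B₂)) u)
       | Y₃ , Y₃⊆B₃ , VY₃≡u ← ∈-span⁻ V B₃ (basis-spans V indep₃ (proj₁ (proj₂ A₂B₃)) u) =
    ∈∧∈⇒∉⊕ y∈Y₁⊕Y₂ y∈Y₂⊕Y₃ (subst (y ∈_) (sym (⊕-cancel-middle Y₁ Y₂ Y₃)) y∈Y₁⊕Y₃)
    where
    separated : ∀ {A B B' Y Y'} → LEdge (suc k) A B → LEdge (suc k) A B' → B ≢ B' → u ∉ₗ span V A →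
                Y ⊆ B → Y' ⊆ B' → lincomb V Y ≡ u → lincomb V Y' ≡ u →
                Y ⊆ B₁ ∪ ⁅ y ⁆ → Y' ⊆ B₁ ∪ ⁅ y ⁆ → y ∈ Y ⊕ Y'
    separated {A} {B} {B'} {Y} {Y'} AB AB' B≢B' u∉A Y⊆B Y'⊆B' VY≡u VY'≡u Y⊆ Y'⊆ with y ∈? (Y ⊕ Y')
    ... | yes y∈ = y∈
    ... | no y∉ = ⊥-elim (u∉A (subst (_∈ₗ span V A) VY≡u (∈-span⁺ V Y⊆A)))
      where
      Y≡Y' : Y ≡ Y'
      Y≡Y' = lincomb-injective-∪⁅⁆ V indep₁ Y⊆ Y'⊆ (trans VY≡u (sym VY'≡u)) y∉
      Y⊆A : Y ⊆ A
      Y⊆A i∈Y = distinct-edges-meet AB AB' B≢B' (Y⊆B i∈Y) (Y'⊆B' (subst (_ ∈_) Y≡Y' i∈Y))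
    Y₁⊆ : Y₁ ⊆ B₁ ∪ ⁅ y ⁆
    Y₁⊆ = p⊆p∪q ⁅ y ⁆ ∘ Y₁⊆B₁
    Y₂⊆ : Y₂ ⊆ B₁ ∪ ⁅ y ⁆
    Y₂⊆ = B₂⊆ ∘ Y₂⊆B₂
    Y₃⊆ : Y₃ ⊆ B₁ ∪ ⁅ y ⁆
    Y₃⊆ = B₃⊆ ∘ Y₃⊆B₃
    y∈Y₁⊕Y₂ : y ∈ Y₁ ⊕ Y₂
    y∈Y₁⊕Y₂ = separated A₁B₁ A₁B₂ B₁≢B₂ u∉A₁ Y₁⊆B₁ Y₂⊆B₂ VY₁≡u VY₂≡u Y₁⊆ Y₂⊆
    y∈Y₂⊕Y₃ : y ∈ Y₂ ⊕ Y₃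
    y∈Y₂⊕Y₃ = separated A₂B₂ A₂B₃ B₂≢B₃ u∉A₂ Y₂⊆B₂ Y₃⊆B₃ VY₂≡u VY₃≡u Y₂⊆ Y₃⊆
    y∈Y₁⊕Y₃ : y ∈ Y₁ ⊕ Y₃
    y∈Y₁⊕Y₃ = separated A₃B₁ A₃B₃ B₁≢B₃ u∉A₃ Y₁⊆B₁ Y₃⊆B₃ VY₁≡u VY₃≡u Y₁⊆ Y₃⊆

next6-period : ∀ i → next6 (next6 (next6 (next6 (next6 (next6 i))))) ≡ i
next6-period zero = refl
next6-period (suc zero) = refl
next6-period (suc (suc zero)) = refl
next6-period (suc (suc (suc zero))) = refl
next6-period (suc (suc (suc (suc zero)))) = refl
next6-period (suc (suc (suc (suc (suc zero))))) = refl

next6-injective : ∀ {i j} → next6 i ≡ next6 j → i ≡ j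
next6-injective {i} {j} eq = trans (sym (next6-period i)) (trans (cong next6⁵ eq) (next6-period j))
  where
  next6⁵ : Fin 6 → Fin 6
  next6⁵ = next6 ∘ next6 ∘ next6 ∘ next6 ∘ next6

rotate : ∀ {r n} {S : Subset n → Bool} → HasC6 r S → HasC6 r S
rotate (v , v-injective , adjacent) = v ∘ next6 , (λ i j → next6-injective ∘ v-injective (next6 i) (next6 j)) , adjacent ∘ next6

module _ {k n : ℕ} (S : Subset n → Bool) where

  adjacent-from-top : ∀ {x y} → ∣ x ∣ ≡ suc k → Adj (suc k) S x y → LEdge (suc k) y x
  adjacent-from-top ∣x∣≡1+k (_ , _ , inj₁ (∣x∣≡k , _)) = ⊥-elim (<⇒≢ (n<1+n k) (trans (sym ∣x∣≡k) ∣x∣≡1+k))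
  adjacent-from-top _ (_ , _ , inj₂ yx) = yx

  adjacent-from-bottom : ∀ {x y} → ∣ x ∣ ≡ k → Adj (suc k) S x y → LEdge (suc k) x y
  adjacent-from-bottom _ (_ , _ , inj₁ xy) = xy
  adjacent-from-bottom ∣x∣≡k (_ , _ , inj₂ (_ , ∣x∣≡1+k , _)) = ⊥-elim (<⇒≢ (n<1+n k) (trans (sym ∣x∣≡k) ∣x∣≡1+k))

module _ {k n : ℕ} (u : Vec Bool (suc k)) (V : Vec (Vec Bool (suc k)) n) where

  selected-top-independent : ∀ {B} → ∣ B ∣ ≡ suc k → T (selected (u ∷ V) B) → Independent V B
  selected-top-independent ∣B∣≡1+k B-selected =
    Equivalence.to (selected-top u V ∣B∣≡1+k) (T-does⁻ (selected? (u ∷ V) _) B-selected)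

  selected-bottom-avoids : ∀ {A} → ∣ A ∣ ≡ k → T (selected (u ∷ V) A) → u ∉ₗ span V A
  selected-bottom-avoids ∣A∣≡k A-selected =
    proj₁ (Equivalence.to (selected-bottom u V ∣A∣≡k) (T-does⁻ (selected? (u ∷ V) _) A-selected))

  no-selected-C6-from-top : (c : HasC6 (suc k) (selected (u ∷ V))) → ∣ proj₁ c (# 0) ∣ ≡ suc k → ⊥
  no-selected-C6-from-top (v , v-injective , adjacent) ∣v₀∣≡1+k =
    no-selected-hexagon u V e₁₀ e₁₂ e₃₂ e₃₄ e₅₄ e₅₀
      (distinct (# 0) (# 2) (λ ())) (distinct (# 2) (# 4) (λ ())) (distinct (# 0) (# 4) (λ ())) (distinct (# 3) (# 5) (λ ()))
      (selected-top-independent ∣v₀∣≡1+k (proj₁ (adjacent (# 0))))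
      (selected-top-independent (proj₁ (proj₂ e₁₂)) (proj₁ (adjacent (# 2))))
      (selected-top-independent (proj₁ (proj₂ e₃₄)) (proj₁ (adjacent (# 4))))
      (selected-bottom-avoids (proj₁ e₁₀) (proj₁ (adjacent (# 1))))
      (selected-bottom-avoids (proj₁ e₃₂) (proj₁ (adjacent (# 3))))
      (selected-bottom-avoids (proj₁ e₅₄) (proj₁ (adjacent (# 5))))
    where
    S : Subset n → Bool
    S = selected (u ∷ V)
    distinct : ∀ i j → i ≢ j → v i ≢ v j
    distinct i j i≢j = i≢j ∘ v-injective i j
    e₁₀ : LEdge (suc k) (v (# 1)) (v (# 0))
    e₁₀ = adjacent-from-top S ∣v₀∣≡1+k (adjacent (# 0))
    e₁₂ : LEdge (suc k) (v (# 1)) (v (# 2))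
    e₁₂ = adjacent-from-bottom S (proj₁ e₁₀) (adjacent (# 1))
    e₃₂ : LEdge (suc k) (v (# 3)) (v (# 2))
    e₃₂ = adjacent-from-top S (proj₁ (proj₂ e₁₂)) (adjacent (# 2))
    e₃₄ : LEdge (suc k) (v (# 3)) (v (# 4))
    e₃₄ = adjacent-from-bottom S (proj₁ e₃₂) (adjacent (# 3))
    e₅₄ : LEdge (suc k) (v (# 5)) (v (# 4))
    e₅₄ = adjacent-from-top S (proj₁ (proj₂ e₃₄)) (adjacent (# 4))
    e₅₀ : LEdge (suc k) (v (# 5)) (v (# 0))
    e₅₀ = adjacent-from-bottom S (proj₁ e₅₄) (adjacent (# 5))

selected-C6Free : ∀ {k n} (V : Vec (Vec Bool (suc k)) (suc n)) → C6Free (suc k) (selected V)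
selected-C6Free (u ∷ V) c@(v , _ , adjacent) with selected-layer (u ∷ V) (v (# 0)) (proj₁ (adjacent (# 0)))
... | inj₂ ∣v₀∣≡1+k = no-selected-C6-from-top u V c ∣v₀∣≡1+k
... | inj₁ ∣v₀∣≡k = no-selected-C6-from-top u V (rotate {S = selected (u ∷ V)} c) (proj₁ (proj₂ (adjacent-from-bottom (selected (u ∷ V)) ∣v₀∣≡k (adjacent (# 0)))))

∃-dense-selection : ∀ k n → ∃ λ (V : Vec (Vec Bool (suc k)) (suc n)) →
  prodNum (suc k) * eLayer n (suc k) ≤ 2 * 2 ^ tri (suc k) * eInduced n (suc k) (selected V)
∃-dense-selection k n = V , density-bound k n (∑-eInduced k n) ∑≤
  where
  edges : Vec (Vec Bool (suc k)) (suc n) → ℕ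
  edges V = eInduced n (suc k) (selected V)
  average : ∃ λ V → ∑ (families (suc k) (suc n)) edges ≤ length (families (suc k) (suc n)) * edges V
  average = ∃-≥-average (replicate _ 𝟎) (families (suc k) (suc n)) edges
  V : Vec (Vec Bool (suc k)) (suc n)
  V = proj₁ average
  ∑≤ : ∑ (families (suc k) (suc n)) edges ≤ (2 ^ suc k) ^ suc n * edges V
  ∑≤ = subst (λ N → ∑ (families (suc k) (suc n)) edges ≤ N * edges V) (length-families (suc k) (suc n)) (proj₂ average)

theorem1p3 : (r n : ℕ) → 1 ≤ r → r ≤ n →
    ∃ λ (S : Subset n → Bool) →
      IsLayerVertexSet r S × C6Free r S × GtHalfC (eInduced n r S) (eLayer n r)
theorem1p3 (suc k) n _ 1+k≤n =
  let (V , dense) = ∃-dense-selection k n in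
  selected V , selected-layer V , selected-C6Free V , ≤⇒GtHalfC (suc k) (eLayer-positive 1+k≤n) dense
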